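{- For every positive integer $n$, there is a bijection between $A(n)$ and $C_{\text{odd}}(n)$. In particular $|A(n)| = |C_{\text{odd}}(n)|$.
   Context: A composition of a positive integer $n$ is a finite sequence $(c_1,\ldots,c_t)$ of positive integers with $\sum c_i = n$. $A(n)$ denotes the set of compositions $(c_1,\ldots,c_t)$ of $n$ such that $c_{2i-1} > c_{2i}$ for every positive integer $i$ with $2i \le t$ (if $t$ is odd, no condition is imposed on the last part). $C_{\text{odd}}(n)$ denotes the set of compositions of $n$ all of whose parts are odd. -}

module Defs where

open import Data.Nat using (ℕ; zero; suc; _<_; _%_)
open import Data.List using (List; []; _∷_)
open import Data.Nat.ListAction using (sum)
open import Data.List.Relation.Unary.All using (All)
open import Data.Product using (Σ; _×_)
open import Data.Unit using (⊤)
open import Relation.Binary.PropositionalEquality using (_≡_)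

IsComposition : ℕ → List ℕ → Set
IsComposition n cs = All (λ c → 0 < c) cs × sum cs ≡ n

PairwiseDescending : List ℕ → Set
PairwiseDescending [] = ⊤
PairwiseDescending (_ ∷ []) = ⊤
PairwiseDescending (c₁ ∷ c₂ ∷ cs) = c₂ < c₁ × PairwiseDescending cs

IsOdd : ℕ → Set
IsOdd c = c % 2 ≡ 1

A : ℕ → Set
A n = Σ (List ℕ) (λ cs → IsComposition n cs × PairwiseDescending cs)

Codd : ℕ → Set
Codd n = Σ (List ℕ) (λ cs → IsComposition n cs × All IsOdd cs)

{-# OPTIONS --safe #-}
-- A pair c₁ > c₂ is sent to c₁ − c₂ − 1 ones followed by the odd part 2c₂ + 1, and an
-- unpaired last part c to c ones. Conversely, reading an odd composition from the left,
-- each odd part 2b + 1 ≥ 3 together with the run of j ones just before it gives back the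
-- pair (b + 1 + j, b), and a final run of j > 0 ones gives back the part j.
module Submission where

open import Defs
open import Data.Nat using (ℕ; zero; suc; _+_; _∸_; _<_; _%_; ⌊_/2⌋; s≤s; z≤n)
open import Data.Nat.Properties
  using (+-suc; +-identityʳ; m≤m+n; m∸n+n≡m; m+n∸m≡n; m+[n∸m]≡n; ≡-irrelevant; <-irrelevant)
open import Data.Nat.ListAction using (sum)
open import Data.Nat.Tactic.RingSolver using (solve-∀)
open import Data.List using (List; []; _∷_; _++_; replicate)
open import Data.List.Relation.Unary.All as All using (All; []; _∷_)
open import Data.Product using (Σ; _×_; _,_)
open import Data.Product.Properties using (Σ-≡,≡→≡)
open import Data.Unit using (tt)
open import Function.Bundles using (_⤖_; mk↔ₛ′)
open import Function.Properties.Inverse using (↔⇒⤖)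
open import Relation.Unary using (Irrelevant; _∩_)
open import Relation.Binary.PropositionalEquality using (_≡_; refl; sym; trans; cong; cong₂; module ≡-Reasoning)

∩-irrelevant : {X : Set} {P Q : X → Set} → Irrelevant P → Irrelevant Q → Irrelevant (P ∩ Q)
∩-irrelevant P-irr Q-irr (p , q) (p′ , q′) = cong₂ _,_ (P-irr p p′) (Q-irr q q′)

Σ-⤖ : {X : Set} {P Q : X → Set} → Irrelevant P → Irrelevant Q →
      (f g : X → X) → (∀ {x} → P x → Q (f x)) → (∀ {y} → Q y → P (g y)) →
      (∀ {y} → Q y → f (g y) ≡ y) → (∀ {x} → P x → g (f x) ≡ x) →
      Σ X P ⤖ Σ X Q
Σ-⤖ P-irr Q-irr f g f-Q g-P f∘g g∘f = ↔⇒⤖ (mk↔ₛ′ F G F∘G G∘F)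
  where
  F = λ { (x , p) → f x , f-Q p }
  G = λ { (y , q) → g y , g-P q }
  F∘G = λ { (y , q) → Σ-≡,≡→≡ (f∘g q , Q-irr _ _) }
  G∘F = λ { (x , p) → Σ-≡,≡→≡ (g∘f p , P-irr _ _) }

IsComposition-irrelevant : ∀ {n} → Irrelevant (IsComposition n)
IsComposition-irrelevant {n} =
  ∩-irrelevant {P = All (0 <_)} {Q = λ cs → sum cs ≡ n} (All.irrelevant <-irrelevant) ≡-irrelevant

PairwiseDescending-irrelevant : Irrelevant PairwiseDescending
PairwiseDescending-irrelevant {[]} tt tt = refl
PairwiseDescending-irrelevant {_ ∷ []} tt tt = refl
PairwiseDescending-irrelevant {_ ∷ _ ∷ _} (p , ps) (q , qs) =
  cong₂ _,_ (<-irrelevant p q) (PairwiseDescending-irrelevant ps qs)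

IsOdd-irrelevant : Irrelevant IsOdd
IsOdd-irrelevant {c} = ≡-irrelevant {c % 2} {1}

A-condition-irrelevant : ∀ {n} → Irrelevant (IsComposition n ∩ PairwiseDescending)
A-condition-irrelevant {n} =
  ∩-irrelevant {P = IsComposition n} {Q = PairwiseDescending} IsComposition-irrelevant
    PairwiseDescending-irrelevant

Codd-condition-irrelevant : ∀ {n} → Irrelevant (IsComposition n ∩ All IsOdd)
Codd-condition-irrelevant {n} =
  ∩-irrelevant {P = IsComposition n} {Q = All IsOdd} IsComposition-irrelevant
    (All.irrelevant (λ {c} → IsOdd-irrelevant {c}))

IsOdd-suc-double : ∀ b → IsOdd (suc (b + b))
IsOdd-suc-double zero = refl
IsOdd-suc-double (suc b) rewrite +-suc b b = IsOdd-suc-double b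

⌊suc[n+n]/2⌋≡n : ∀ n → ⌊ suc (n + n) /2⌋ ≡ n
⌊suc[n+n]/2⌋≡n zero = refl
⌊suc[n+n]/2⌋≡n (suc n) rewrite +-suc n n = cong suc (⌊suc[n+n]/2⌋≡n n)

odd⇒suc[⌊n/2⌋+⌊n/2⌋]≡n : ∀ {n} → IsOdd n → suc (⌊ n /2⌋ + ⌊ n /2⌋) ≡ n
odd⇒suc[⌊n/2⌋+⌊n/2⌋]≡n {suc zero} _ = refl
odd⇒suc[⌊n/2⌋+⌊n/2⌋]≡n {suc (suc n)} odd =
  cong (λ m → suc (suc m)) (trans (+-suc ⌊ n /2⌋ ⌊ n /2⌋) (odd⇒suc[⌊n/2⌋+⌊n/2⌋]≡n odd))

ones : ℕ → List ℕ → List ℕ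
ones k xs = replicate k 1 ++ xs

sum-ones : ∀ k xs → sum (ones k xs) ≡ k + sum xs
sum-ones zero xs = refl
sum-ones (suc k) xs = cong suc (sum-ones k xs)

ones-positive : ∀ k {xs} → All (0 <_) xs → All (0 <_) (ones k xs)
ones-positive zero ps = ps
ones-positive (suc k) ps = s≤s z≤n ∷ ones-positive k ps

ones-odd : ∀ k {xs} → All IsOdd xs → All IsOdd (ones k xs)
ones-odd zero os = os
ones-odd (suc k) os = refl ∷ ones-odd k os

ones-suc : ∀ k xs → ones (suc k) xs ≡ ones k (1 ∷ xs)
ones-suc zero xs = refl
ones-suc (suc k) xs = cong (1 ∷_) (ones-suc k xs)

toOdd : List ℕ → List ℕ
toOdd [] = []
toOdd (c ∷ []) = ones c []
toOdd (c₁ ∷ c₂ ∷ cs) = ones (c₁ ∸ suc c₂) (suc (c₂ + c₂) ∷ toOdd cs)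

trailingPart : ℕ → List ℕ
trailingPart zero = []
trailingPart (suc j) = suc j ∷ []

-- fromOdd j xs decodes ones j xs. Parts 0 never occur in odd compositions.
fromOdd : ℕ → List ℕ → List ℕ
fromOdd j [] = trailingPart j
fromOdd j (zero ∷ xs) = fromOdd j xs
fromOdd j (suc zero ∷ xs) = fromOdd (suc j) xs
fromOdd j (x@(suc (suc _)) ∷ xs) = suc (⌊ x /2⌋ + j) ∷ ⌊ x /2⌋ ∷ fromOdd 0 xs

fromOdd-ones : ∀ j k xs → fromOdd j (ones k xs) ≡ fromOdd (j + k) xs
fromOdd-ones j zero xs = cong (λ i → fromOdd i xs) (sym (+-identityʳ j))
fromOdd-ones j (suc k) xs =
  trans (fromOdd-ones (suc j) k xs) (cong (λ i → fromOdd i xs) (sym (+-suc j k)))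

toOdd-positive : ∀ {cs} → PairwiseDescending cs → All (0 <_) (toOdd cs)
toOdd-positive {[]} _ = []
toOdd-positive {c ∷ []} _ = ones-positive c []
toOdd-positive {c₁ ∷ c₂ ∷ cs} (_ , pd) = ones-positive (c₁ ∸ suc c₂) (s≤s z≤n ∷ toOdd-positive pd)

toOdd-odd : ∀ cs → All IsOdd (toOdd cs)
toOdd-odd [] = []
toOdd-odd (c ∷ []) = ones-odd c []
toOdd-odd (c₁ ∷ c₂ ∷ cs) = ones-odd (c₁ ∸ suc c₂) (IsOdd-suc-double c₂ ∷ toOdd-odd cs)

sum-toOdd : ∀ {cs} → PairwiseDescending cs → sum (toOdd cs) ≡ sum cs
sum-toOdd {[]} _ = refl
sum-toOdd {c ∷ []} _ = sum-ones c []
sum-toOdd {c₁ ∷ c₂ ∷ cs} (c₂<c₁ , pd) = begin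
  sum (ones (c₁ ∸ suc c₂) (suc (c₂ + c₂) ∷ toOdd cs)) ≡⟨ sum-ones (c₁ ∸ suc c₂) _ ⟩
  c₁ ∸ suc c₂ + (suc (c₂ + c₂) + sum (toOdd cs))      ≡⟨ regroup (c₁ ∸ suc c₂) c₂ _ ⟩
  (c₁ ∸ suc c₂ + suc c₂) + (c₂ + sum (toOdd cs))
    ≡⟨ cong₂ (λ a s → a + (c₂ + s)) (m∸n+n≡m c₂<c₁) (sum-toOdd pd) ⟩
  c₁ + (c₂ + sum cs)                                  ∎
  where
  open ≡-Reasoning
  regroup : ∀ k b s → k + (suc (b + b) + s) ≡ (k + suc b) + (b + s)
  regroup = solve-∀

fromOdd-descending : ∀ j xs → PairwiseDescending (fromOdd j xs)
fromOdd-descending zero [] = tt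
fromOdd-descending (suc j) [] = tt
fromOdd-descending j (zero ∷ xs) = fromOdd-descending j xs
fromOdd-descending j (suc zero ∷ xs) = fromOdd-descending (suc j) xs
fromOdd-descending j (x@(suc (suc _)) ∷ xs) = s≤s (m≤m+n ⌊ x /2⌋ j) , fromOdd-descending 0 xs

fromOdd-positive : ∀ j xs → All (0 <_) (fromOdd j xs)
fromOdd-positive zero [] = []
fromOdd-positive (suc j) [] = s≤s z≤n ∷ []
fromOdd-positive j (zero ∷ xs) = fromOdd-positive j xs
fromOdd-positive j (suc zero ∷ xs) = fromOdd-positive (suc j) xs
fromOdd-positive j (suc (suc _) ∷ xs) = s≤s z≤n ∷ s≤s z≤n ∷ fromOdd-positive 0 xs

sum-fromOdd : ∀ j {xs} → All IsOdd xs → sum (fromOdd j xs) ≡ j + sum xs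
sum-fromOdd zero [] = refl
sum-fromOdd (suc j) [] = refl
sum-fromOdd j {suc zero ∷ xs} (_ ∷ os) = trans (sum-fromOdd (suc j) os) (sym (+-suc j (sum xs)))
sum-fromOdd j {x@(suc (suc _)) ∷ xs} (odd ∷ os) = begin
  suc (b + j) + (b + sum (fromOdd 0 xs)) ≡⟨ cong (λ s → suc (b + j) + (b + s)) (sum-fromOdd 0 os) ⟩
  suc (b + j) + (b + sum xs)             ≡⟨ regroup b j (sum xs) ⟩
  j + (suc (b + b) + sum xs)             ≡⟨ cong (λ y → j + (y + sum xs)) (odd⇒suc[⌊n/2⌋+⌊n/2⌋]≡n odd) ⟩
  j + (x + sum xs)                       ∎
  where
  open ≡-Reasoning
  b = ⌊ x /2⌋
  regroup : ∀ b j s → suc (b + j) + (b + s) ≡ j + (suc (b + b) + s)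
  regroup = solve-∀

toOdd-fromOdd : ∀ j {xs} → All IsOdd xs → toOdd (fromOdd j xs) ≡ ones j xs
toOdd-fromOdd zero [] = refl
toOdd-fromOdd (suc j) [] = refl
toOdd-fromOdd j {suc zero ∷ xs} (_ ∷ os) = trans (toOdd-fromOdd (suc j) os) (ones-suc j xs)
toOdd-fromOdd j {x@(suc (suc _)) ∷ xs} (odd ∷ os) =
  cong₂ ones (m+n∸m≡n (suc ⌊ x /2⌋) j)
        (cong₂ _∷_ (odd⇒suc[⌊n/2⌋+⌊n/2⌋]≡n odd) (toOdd-fromOdd 0 os))

fromOdd-toOdd : ∀ {cs} → All (0 <_) cs → PairwiseDescending cs → fromOdd 0 (toOdd cs) ≡ cs
fromOdd-toOdd {[]} _ _ = refl
fromOdd-toOdd {suc c ∷ []} _ _ = fromOdd-ones 0 (suc c) []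
fromOdd-toOdd {c₁ ∷ suc c₂ ∷ cs} (_ ∷ _ ∷ ps) (c₂<c₁ , pd) = begin
  fromOdd 0 (ones k (suc (suc c₂ + suc c₂) ∷ toOdd cs))       ≡⟨ fromOdd-ones 0 k _ ⟩
  suc (⌊ suc (suc c₂ + suc c₂) /2⌋ + k) ∷ ⌊ suc (suc c₂ + suc c₂) /2⌋ ∷ fromOdd 0 (toOdd cs)
    ≡⟨ cong₂ (λ b ys → suc (b + k) ∷ b ∷ ys) (⌊suc[n+n]/2⌋≡n (suc c₂)) (fromOdd-toOdd ps pd) ⟩
  suc (suc c₂ + k) ∷ suc c₂ ∷ cs                              ≡⟨ cong (λ c → c ∷ suc c₂ ∷ cs) (m+[n∸m]≡n c₂<c₁) ⟩
  c₁ ∷ suc c₂ ∷ cs                                            ∎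
  where
  open ≡-Reasoning
  k = c₁ ∸ suc (suc c₂)

toOdd-preserves : ∀ {n cs} → IsComposition n cs × PairwiseDescending cs →
                  IsComposition n (toOdd cs) × All IsOdd (toOdd cs)
toOdd-preserves {cs = cs} ((_ , sum≡n) , pd) =
  (toOdd-positive pd , trans (sum-toOdd pd) sum≡n) , toOdd-odd cs

fromOdd-preserves : ∀ {n xs} → IsComposition n xs × All IsOdd xs →
                    IsComposition n (fromOdd 0 xs) × PairwiseDescending (fromOdd 0 xs)
fromOdd-preserves {xs = xs} ((_ , sum≡n) , os) =
  (fromOdd-positive 0 xs , trans (sum-fromOdd 0 os) sum≡n) , fromOdd-descending 0 xs

theorem2p1 : (n : ℕ) → 0 < n → A n ⤖ Codd n
theorem2p1 n _ =
  Σ-⤖ A-condition-irrelevant Codd-condition-irrelevant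
      toOdd (fromOdd 0) toOdd-preserves fromOdd-preserves
      (λ (_ , os) → toOdd-fromOdd 0 os)
      (λ ((ps , _) , pd) → fromOdd-toOdd ps pd)
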